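{- Let $p$ be a Sophie Germain prime and let $k\geq 1$ be an integer. Then the only non-negative integer solutions $(y,z)$ of the Diophantine equation $1+(2^k(2p+1))^y=z^2$ occur for $(p,k,y,z)=(2,4,1,9)$ and $(p,k,y,z)=(3,5,1,15)$.
   Context: A prime $p$ is called a Sophie Germain prime if $2p+1$ is also prime. -}

module Defs where

open import Data.Nat using (ℕ; _+_; _*_)
open import Data.Nat.Primality using (Prime)
open import Data.Product using (_×_)

SophieGermainPrime : ℕ → Set
SophieGermainPrime p = Prime p × Prime (2 * p + 1)

-- Write q = 2p + 1.  For y = 0 the equation reads z² = 2.  Otherwise z is odd, z = 2a + 1, and
-- 4a(a + 1) = 2^(ky) q^y.  The prime q divides one of the coprime numbers a, a + 1; the other one
-- is then a power of two, and comparing 2-adic parts the first one is exactly q^y, so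
-- q^y ± 1 = 2^i.  For y ≥ 2 this is impossible: for odd y, q^y ± 1 = (q ± 1)·(an odd number > 1);
-- for even y, q^y = w² with w ≥ 5 odd, while w² + 1 = 2^i forces w = 1 and w² − 1 = 4b(b + 1) = 2^i
-- forces b ≤ 1.  For y = 1, q − 1 = 2^i makes the prime p a power of two, so p = 2; and q + 1 = 2^i
-- makes p + 1 a power of two, which with q prime leaves only p ≡ 0 (mod 3), so p = 3.

module Submission where

open import Defs
open import Data.Nat using (ℕ; zero; suc; _+_; _*_; _^_; _≤_; _<_; z≤n; s≤s; nonTrivial⇒n>1)
open import Data.Nat.Properties
open import Data.Nat.Divisibility
open import Data.Nat.Coprimality using (Coprime; coprime-divisor)
open import Data.Nat.Primality
  using (Prime; prime[2]; ¬prime[1]; prime⇒nonTrivial; prime⇒nonZero; prime⇒irreducible;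
         euclidsLemma)
open import Data.Nat.Tactic.RingSolver using (solve-∀)
open import Data.Product using (_×_; _,_; proj₁; proj₂; ∃-syntax)
open import Data.Sum using (_⊎_; inj₁; inj₂; [_,_]′)
open import Relation.Binary.Definitions using (tri<; tri≈; tri>)
open import Relation.Nullary using (contradiction; yes; no)
open import Relation.Binary.PropositionalEquality

even-or-odd : ∀ n → ∃[ b ] (n ≡ 2 * b ⊎ n ≡ 1 + 2 * b)
even-or-odd zero = 0 , inj₁ refl
even-or-odd (suc zero) = 0 , inj₂ refl
even-or-odd (suc (suc n)) with even-or-odd n
... | b , inj₁ refl = suc b , inj₁ (sym (*-suc 2 b))
... | b , inj₂ refl = suc b , inj₂ (cong suc (sym (*-suc 2 b)))

residue-mod-3 : ∀ n → ∃[ m ] (n ≡ 3 * m ⊎ n ≡ 1 + 3 * m ⊎ n ≡ 2 + 3 * m)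
residue-mod-3 0 = 0 , inj₁ refl
residue-mod-3 1 = 0 , inj₂ (inj₁ refl)
residue-mod-3 2 = 0 , inj₂ (inj₂ refl)
residue-mod-3 (suc (suc (suc n))) with residue-mod-3 n
... | m , inj₁ refl = suc m , inj₁ (sym (*-suc 3 m))
... | m , inj₂ (inj₁ refl) = suc m , inj₂ (inj₁ (cong suc (sym (*-suc 3 m))))
... | m , inj₂ (inj₂ refl) = suc m , inj₂ (inj₂ (cong (2 +_) (sym (*-suc 3 m))))

2∤1+2* : ∀ b → 2 ∤ 1 + 2 * b
2∤1+2* b (divides c eq) = even≢odd c b (sym (trans eq (*-comm c 2)))

[1+2r]^n-odd : ∀ r n → ∃[ c ] (1 + 2 * r) ^ n ≡ 1 + 2 * c
[1+2r]^n-odd r zero = 0 , refl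
[1+2r]^n-odd r (suc n) with [1+2r]^n-odd r n
... | c , eq = r + c + 2 * r * c , trans (cong ((1 + 2 * r) *_) eq) (product r c)
  where
  product : ∀ r c → (1 + 2 * r) * (1 + 2 * c) ≡ 1 + 2 * (r + c + 2 * r * c)
  product = solve-∀

[1+2a]^2≡1+a[1+a]*4 : ∀ a → (1 + 2 * a) ^ 2 ≡ 1 + a * (1 + a) * 4
[1+2a]^2≡1+a[1+a]*4 = square
  where
  square : ∀ a → (1 + 2 * a) * ((1 + 2 * a) * 1) ≡ 1 + a * (1 + a) * 4
  square = solve-∀

^-distrib-* : ∀ m n k → (m * n) ^ k ≡ m ^ k * n ^ k
^-distrib-* m n zero = refl
^-distrib-* m n (suc k) = trans (cong (m * n *_) (^-distrib-* m n k)) (interchange m n (m ^ k) (n ^ k))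
  where
  interchange : ∀ a b c d → a * b * (c * d) ≡ a * c * (b * d)
  interchange = solve-∀

^-injectiveʳ : ∀ m {i j} → 1 < m → m ^ i ≡ m ^ j → i ≡ j
^-injectiveʳ m {i} {j} 1<m eq with <-cmp i j
... | tri< i<j _ _ = contradiction eq (<⇒≢ (^-monoʳ-< m 1<m i<j))
... | tri≈ _ i≡j _ = i≡j
... | tri> _ _ j<i = contradiction (sym eq) (<⇒≢ (^-monoʳ-< m 1<m j<i))

2≢n^2 : ∀ n → 2 ≢ n ^ 2
2≢n^2 0 ()
2≢n^2 1 ()
2≢n^2 (suc (suc n)) eq =
  contradiction (subst (4 ≤_) (sym eq) (^-monoˡ-≤ 2 {2} {2 + n} (s≤s (s≤s z≤n))))
                λ { (s≤s (s≤s ())) }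

prime⇒2≤ : ∀ {p} → Prime p → 2 ≤ p
prime⇒2≤ {p} pp = nonTrivial⇒n>1 p {{prime⇒nonTrivial pp}}

n^2-odd⇒n-odd : ∀ {n x} → n ^ 2 ≡ 1 + 2 * x → ∃[ a ] n ≡ 1 + 2 * a
n^2-odd⇒n-odd {n} {x} eq with even-or-odd n
... | a , inj₂ n≡1+2a = a , n≡1+2a
... | c , inj₁ refl =
  contradiction (trans (sym (*-assoc 2 c (2 * c * 1))) eq) (even≢odd (c * (2 * c * 1)) x)

∣n∧∣1+n⇒∣1 : ∀ {d n} → d ∣ n → d ∣ 1 + n → d ∣ 1
∣n∧∣1+n⇒∣1 {d} {n} d∣n d∣1+n = ∣m+n∣m⇒∣n (subst (d ∣_) (+-comm 1 n) d∣1+n) d∣n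

prime∤⇒coprime : ∀ {p n} → Prime p → p ∤ n → Coprime n p
prime∤⇒coprime pp p∤n (d∣n , d∣p) with prime⇒irreducible pp d∣p
... | inj₁ d≡1 = d≡1
... | inj₂ refl = contradiction d∣n p∤n

coprime-divisor-^ : ∀ {d c} n {m} → Coprime d c → d ∣ c ^ n * m → d ∣ m
coprime-divisor-^ zero cop d∣ = subst (_ ∣_) (*-identityˡ _) d∣
coprime-divisor-^ {d} {c} (suc n) {m} cop d∣ =
  coprime-divisor-^ n cop (coprime-divisor cop (subst (d ∣_) (*-assoc c (c ^ n) m) d∣))

∣p^n⇒≡p^i : ∀ {p d} n → Prime p → d ∣ p ^ n → ∃[ i ] d ≡ p ^ i
∣p^n⇒≡p^i zero pp d∣1 = 0 , ∣1⇒≡1 d∣1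
∣p^n⇒≡p^i {p} {d} (suc n) pp d∣ with p ∣? d
... | no p∤d = ∣p^n⇒≡p^i n pp (coprime-divisor (prime∤⇒coprime pp p∤d) d∣)
... | yes (divides e refl)
  with ∣p^n⇒≡p^i n pp
         (*-cancelˡ-∣ p {{prime⇒nonZero pp}} (subst (_∣ p ^ suc n) (*-comm e p) d∣))
...   | i , refl = suc i , *-comm (p ^ i) p

prime∣q^n⇒≡q : ∀ {p q} n → Prime p → Prime q → p ∣ q ^ n → p ≡ q
prime∣q^n⇒≡q zero pp pq p∣1 = contradiction (subst Prime (∣1⇒≡1 p∣1) pp) ¬prime[1]
prime∣q^n⇒≡q {q = q} (suc n) pp pq p∣ with euclidsLemma q (q ^ n) pp p∣
... | inj₂ p∣q^n = prime∣q^n⇒≡q n pp pq p∣q^n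
... | inj₁ p∣q with prime⇒irreducible pq p∣q
...   | inj₁ refl = contradiction pp ¬prime[1]
...   | inj₂ p≡q = p≡q

odd-prime∤2^n : ∀ {r} n → Prime (1 + 2 * r) → 1 + 2 * r ∤ 2 ^ n
odd-prime∤2^n {r} n pq q∣ = 2∤1+2* r (∣-reflexive (sym (prime∣q^n⇒≡q n pq prime[2] q∣)))

1+2b∣2^n⇒b≡0 : ∀ {b} n → 1 + 2 * b ∣ 2 ^ n → b ≡ 0
1+2b∣2^n⇒b≡0 {zero} n _ = refl
1+2b∣2^n⇒b≡0 {suc b} n d∣
  with ∣1⇒≡1 (coprime-divisor-^ n (prime∤⇒coprime prime[2] (2∤1+2* (suc b)))
                                  (subst (_ ∣_) (sym (*-identityʳ (2 ^ n))) d∣))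
... | ()

2^i*odd-injective : ∀ i j A B → 2 ^ i * (1 + 2 * A) ≡ 2 ^ j * (1 + 2 * B) → i ≡ j × A ≡ B
2^i*odd-injective zero zero A B eq =
  refl , *-cancelˡ-≡ A B 2 (suc-injective (trans (sym (*-identityˡ _)) (trans eq (*-identityˡ _))))
2^i*odd-injective zero (suc j) A B eq =
  contradiction (trans (sym (*-assoc 2 (2 ^ j) (1 + 2 * B))) (trans (sym eq) (*-identityˡ _)))
                (even≢odd (2 ^ j * (1 + 2 * B)) A)
2^i*odd-injective (suc i) zero A B eq =
  contradiction (trans (sym (*-assoc 2 (2 ^ i) (1 + 2 * A))) (trans eq (*-identityˡ _)))
                (even≢odd (2 ^ i * (1 + 2 * A)) B)
2^i*odd-injective (suc i) (suc j) A B eq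
  with 2^i*odd-injective i j A B (*-cancelˡ-≡ _ _ 2 halved)
  where
  halved : 2 * (2 ^ i * (1 + 2 * A)) ≡ 2 * (2 ^ j * (1 + 2 * B))
  halved = trans (sym (*-assoc 2 (2 ^ i) (1 + 2 * A))) (trans eq (*-assoc 2 (2 ^ j) (1 + 2 * B)))
... | refl , A≡B = refl , A≡B

module ConsecutiveProduct {r} (pq : Prime (1 + 2 * r)) (n : ℕ) where

  q : ℕ
  q = 1 + 2 * r

  Q : ℕ
  Q = q ^ suc n

  B : ℕ
  B = proj₁ ([1+2r]^n-odd r (suc n))

  Q≡1+2B : Q ≡ 1 + 2 * B
  Q≡1+2B = proj₂ ([1+2r]^n-odd r (suc n))

  q∤2^ : ∀ m → q ∤ 2 ^ m
  q∤2^ m = odd-prime∤2^n {r} m pq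

  coprime-factor-power-of-2 : ∀ y E → y ∣ 2 ^ E * Q → q ∤ y → ∃[ j ] y ≡ 2 ^ j
  coprime-factor-power-of-2 y E y∣ q∤y = ∣p^n⇒≡p^i E prime[2]
    (coprime-divisor-^ (suc n) (prime∤⇒coprime pq q∤y) (subst (y ∣_) (*-comm (2 ^ E) Q) y∣))

  odd-factor≡Q : ∀ c j E → 2 ^ j * (1 + 2 * c) * 4 ≡ 2 ^ E * Q → E ≡ j + 2 × 1 + 2 * c ≡ Q
  odd-factor≡Q c j E eq with 2^i*odd-injective (j + 2) E c B eq′
    where
    shuffle : ∀ x y → y * 4 * x ≡ y * x * 4
    shuffle = solve-∀
    eq′ : 2 ^ (j + 2) * (1 + 2 * c) ≡ 2 ^ E * (1 + 2 * B)
    eq′ = trans (cong (_* (1 + 2 * c)) (^-distribˡ-+-* 2 j 2))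
                (trans (shuffle (1 + 2 * c) (2 ^ j)) (trans eq (cong (2 ^ E *_) Q≡1+2B)))
  ... | j+2≡E , refl = sym j+2≡E , sym Q≡1+2B

  split-q∣a : ∀ a E → a * (1 + a) * 4 ≡ 2 ^ E * Q → q ∣ a →
              ∃[ i ] E ≡ i + 2 × a ≡ Q × 1 + a ≡ 2 ^ i
  split-q∣a a E eq q∣a
    with coprime-factor-power-of-2 (1 + a) E (subst (1 + a ∣_) eq (∣m⇒∣m*n 4 (n∣m*n a)))
                                   (λ q∣1+a → q∤2^ 0 (∣n∧∣1+n⇒∣1 q∣a q∣1+a))
  ... | zero , refl =
    contradiction (m^n≡0⇒m≡0 2 E (m*n≡0⇒m≡0 _ _ (sym (trans eq (cong (2 ^ E *_) Q≡1+2B))))) λ ()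
  ... | suc j , 1+a≡2^i with even-or-odd a
  ...   | c , inj₁ refl = contradiction (sym 1+a≡2^i) (even≢odd (2 ^ j) c)
  ...   | c , inj₂ refl
    with odd-factor≡Q c (suc j) E
           (trans (cong (_* 4) (trans (cong (_* (1 + 2 * c)) (sym 1+a≡2^i)) (*-comm (1 + a) a))) eq)
  ...     | E≡ , a≡Q = suc j , E≡ , a≡Q , 1+a≡2^i

  split-q∣1+a : ∀ a E → a * (1 + a) * 4 ≡ 2 ^ E * Q → q ∣ 1 + a →
                ∃[ i ] E ≡ i + 2 × 1 + a ≡ Q × a ≡ 2 ^ i
  split-q∣1+a a E eq q∣1+a
    with coprime-factor-power-of-2 a E (subst (a ∣_) eq (∣m⇒∣m*n 4 (m∣m*n (1 + a))))
                                   (λ q∣a → q∤2^ 0 (∣n∧∣1+n⇒∣1 q∣a q∣1+a))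
  ... | zero , refl = contradiction q∣1+a (q∤2^ 1)
  ... | suc j , refl with odd-factor≡Q (2 ^ j) (suc j) E eq
  ...   | E≡ , 1+a≡Q = suc j , E≡ , 1+a≡Q , refl

  q∣a⊎q∣1+a : ∀ a E → a * (1 + a) * 4 ≡ 2 ^ E * Q → q ∣ a ⊎ q ∣ 1 + a
  q∣a⊎q∣1+a a E eq
    with euclidsLemma (a * (1 + a)) 4 pq (subst (q ∣_) (sym eq) (∣n⇒∣m*n (2 ^ E) (m∣m*n (q ^ n))))
  ... | inj₁ q∣a[1+a] = euclidsLemma a (1 + a) pq q∣a[1+a]
  ... | inj₂ q∣4 = contradiction q∣4 (q∤2^ 2)

  consecutive-product-split : ∀ a E → a * (1 + a) * 4 ≡ 2 ^ E * Q →
    ∃[ i ] E ≡ i + 2 × (a ≡ Q × 1 + a ≡ 2 ^ i ⊎ 1 + a ≡ Q × a ≡ 2 ^ i)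
  consecutive-product-split a E eq with q∣a⊎q∣1+a a E eq
  ... | inj₁ q∣a with split-q∣a a E eq q∣a
  ...   | i , E≡i+2 , a≡Q×1+a≡2^i = i , E≡i+2 , inj₁ a≡Q×1+a≡2^i
  consecutive-product-split a E eq | inj₂ q∣1+a with split-q∣1+a a E eq q∣1+a
  ...   | i , E≡i+2 , 1+a≡Q×a≡2^i = i , E≡i+2 , inj₂ 1+a≡Q×a≡2^i

open ConsecutiveProduct using (consecutive-product-split)

evenPowerSum : ℕ → ℕ → ℕ
evenPowerSum q zero = 0
evenPowerSum q (suc t) = 1 + q * q * evenPowerSum q t

-- q^(2t+1) = q + q(q² − 1)·Σ_{j<t} q^(2j), written with q = 1 + m so that no subtraction occurs.
[1+m]^odd-expansion : ∀ m t →
  (1 + m) ^ (1 + 2 * t) ≡ 1 + m * (1 + (1 + m) * (2 + m) * evenPowerSum (1 + m) t)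
[1+m]^odd-expansion m zero = base m
  where
  base : ∀ m → (1 + m) * 1 ≡ 1 + m * (1 + (1 + m) * (2 + m) * 0)
  base = solve-∀
[1+m]^odd-expansion m (suc t) = begin
  (1 + m) ^ (1 + 2 * suc t)
    ≡⟨ cong (λ e → (1 + m) ^ (1 + e)) (*-suc 2 t) ⟩
  (1 + m) * ((1 + m) * (1 + m) ^ (1 + 2 * t))
    ≡⟨ cong (λ x → (1 + m) * ((1 + m) * x)) ([1+m]^odd-expansion m t) ⟩
  (1 + m) * ((1 + m) * (1 + m * (1 + (1 + m) * (2 + m) * S)))
    ≡⟨ step m S ⟩
  1 + m * (1 + (1 + m) * (2 + m) * (1 + (1 + m) * (1 + m) * S)) ∎
  where
  open ≡-Reasoning
  S : ℕ
  S = evenPowerSum (1 + m) t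
  step : ∀ m S → (1 + m) * ((1 + m) * (1 + m * (1 + (1 + m) * (2 + m) * S)))
                 ≡ 1 + m * (1 + (1 + m) * (2 + m) * (1 + (1 + m) * (1 + m) * S))
  step = solve-∀

1+[1+2p]^odd≢2^i : ∀ p t i → 1 + (1 + 2 * suc p) ^ (1 + 2 * suc t) ≢ 2 ^ i
1+[1+2p]^odd≢2^i p t i eq =
  contradiction (1+2b∣2^n⇒b≡0 {suc p * (1 + 2 * suc p) * S} i cofactor∣2^i) λ ()
  where
  S : ℕ
  S = evenPowerSum (1 + 2 * suc p) (suc t)
  regroup : ∀ P S → 1 + (1 + 2 * P * (1 + (1 + 2 * P) * (2 + 2 * P) * S))
                    ≡ (2 + 2 * P) * (1 + 2 * (P * (1 + 2 * P) * S))
  regroup = solve-∀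
  cofactor∣2^i : 1 + 2 * (suc p * (1 + 2 * suc p) * S) ∣ 2 ^ i
  cofactor∣2^i = divides (2 + 2 * suc p)
    (trans (sym eq) (trans (cong suc ([1+m]^odd-expansion (2 * suc p) (suc t))) (regroup (suc p) S)))

[1+2p]^odd≢1+2^i : ∀ p t i → (1 + 2 * suc p) ^ (1 + 2 * suc t) ≢ 1 + 2 ^ i
[1+2p]^odd≢1+2^i p t i eq =
  contradiction (1+2b∣2^n⇒b≡0 {(1 + 2 * suc p) * (1 + suc p) * S} i cofactor∣2^i) λ ()
  where
  S : ℕ
  S = evenPowerSum (1 + 2 * suc p) (suc t)
  2^i≡ : 2 * suc p * (1 + (1 + 2 * suc p) * (2 + 2 * suc p) * S) ≡ 2 ^ i
  2^i≡ = suc-injective (trans (sym ([1+m]^odd-expansion (2 * suc p) (suc t))) eq)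
  regroup : ∀ P S → 2 * P * (1 + (1 + 2 * P) * (2 + 2 * P) * S)
                    ≡ 2 * P * (1 + 2 * ((1 + 2 * P) * (1 + P) * S))
  regroup = solve-∀
  cofactor∣2^i : 1 + 2 * ((1 + 2 * suc p) * (1 + suc p) * S) ∣ 2 ^ i
  cofactor∣2^i = divides (2 * suc p) (trans (sym 2^i≡) (regroup (suc p) S))

1+[1+2b]^2≡2^i⇒b≡0 : ∀ b i → 1 + (1 + 2 * b) ^ 2 ≡ 2 ^ i → b ≡ 0
1+[1+2b]^2≡2^i⇒b≡0 b i eq = halve b i (trans (sym (regroup b)) eq)
  where
  double : ∀ x → 1 + (1 + x * 4) ≡ 2 * (1 + 2 * x)
  double = solve-∀
  regroup : ∀ b → 1 + (1 + 2 * b) ^ 2 ≡ 2 * (1 + 2 * (b * (1 + b)))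
  regroup b = trans (cong suc ([1+2a]^2≡1+a[1+a]*4 b)) (double (b * (1 + b)))
  halve : ∀ b i → 2 * (1 + 2 * (b * (1 + b))) ≡ 2 ^ i → b ≡ 0
  halve b zero e = contradiction e (even≢odd (1 + 2 * (b * (1 + b))) 0)
  halve zero (suc i) e = refl
  halve (suc b) (suc i) e =
    contradiction (1+2b∣2^n⇒b≡0 {suc b * (1 + suc b)} i (∣-reflexive (*-cancelˡ-≡ _ (2 ^ i) 2 e))) λ ()

[1+2b]^2≡1+2^i⇒b≤1 : ∀ b i → (1 + 2 * b) ^ 2 ≡ 1 + 2 ^ i → b ≤ 1
[1+2b]^2≡1+2^i⇒b≤1 b i eq = bound b (suc-injective (trans (sym ([1+2a]^2≡1+a[1+a]*4 b)) eq))
  where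
  bound : ∀ b → b * (1 + b) * 4 ≡ 2 ^ i → b ≤ 1
  bound b e with even-or-odd b
  ... | c , inj₁ refl
    with 1+2b∣2^n⇒b≡0 {c} i (subst (1 + 2 * c ∣_) e (∣m⇒∣m*n 4 (n∣m*n (2 * c))))
  ...   | refl = z≤n
  bound b e | c , inj₂ refl
    with 1+2b∣2^n⇒b≡0 {c} i (subst (1 + 2 * c ∣_) e (∣m⇒∣m*n 4 (m∣m*n (2 + 2 * c))))
  ...   | refl = s≤s z≤n

m^[2t]≡[m^t]^2 : ∀ m t → m ^ (2 * t) ≡ (m ^ t) ^ 2
m^[2t]≡[m^t]^2 m t = trans (cong (m ^_) (*-comm 2 t)) (sym (^-*-assoc m t 2))

1+[1+2p]^even≢2^i : ∀ p t i → 1 + (1 + 2 * suc p) ^ (2 * suc t) ≢ 2 ^ i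
1+[1+2p]^even≢2^i p t i eq = [ (λ ()) , (λ ()) ]′ (m^n≡1⇒n≡0∨m≡1 q (suc t) q^t≡1)
  where
  q : ℕ
  q = 1 + 2 * suc p
  c : ℕ
  c = proj₁ ([1+2r]^n-odd (suc p) (suc t))
  q^t≡1+2c : q ^ suc t ≡ 1 + 2 * c
  q^t≡1+2c = proj₂ ([1+2r]^n-odd (suc p) (suc t))
  c≡0 : c ≡ 0
  c≡0 = 1+[1+2b]^2≡2^i⇒b≡0 c i
          (subst (λ x → 1 + x ^ 2 ≡ 2 ^ i) q^t≡1+2c
                 (trans (cong suc (sym (m^[2t]≡[m^t]^2 q (suc t)))) eq))
  q^t≡1 : q ^ suc t ≡ 1
  q^t≡1 = trans q^t≡1+2c (cong (λ c → 1 + 2 * c) c≡0)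

[1+2p]^even≢1+2^i : ∀ p t i → (1 + 2 * suc (suc p)) ^ (2 * suc t) ≢ 1 + 2 ^ i
[1+2p]^even≢1+2^i p t i eq = contradiction 5≤3 λ { (s≤s (s≤s (s≤s ()))) }
  where
  open ≤-Reasoning
  q : ℕ
  q = 1 + 2 * suc (suc p)
  c : ℕ
  c = proj₁ ([1+2r]^n-odd (suc (suc p)) (suc t))
  q^t≡1+2c : q ^ suc t ≡ 1 + 2 * c
  q^t≡1+2c = proj₂ ([1+2r]^n-odd (suc (suc p)) (suc t))
  c≤1 : c ≤ 1
  c≤1 = [1+2b]^2≡1+2^i⇒b≤1 c i
          (subst (λ x → x ^ 2 ≡ 1 + 2 ^ i) q^t≡1+2c (trans (sym (m^[2t]≡[m^t]^2 q (suc t))) eq))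
  5≤3 : 5 ≤ 3
  5≤3 = begin
    5             ≤⟨ s≤s (*-monoʳ-≤ 2 (s≤s (s≤s z≤n))) ⟩
    q             ≡⟨ sym (*-identityʳ q) ⟩
    q ^ 1         ≤⟨ ^-monoʳ-≤ q {1} {suc t} (s≤s z≤n) ⟩
    q ^ suc t     ≡⟨ q^t≡1+2c ⟩
    1 + 2 * c     ≤⟨ s≤s (*-monoʳ-≤ 2 c≤1) ⟩
    3             ∎

1+[1+2p]^n≢2^i : ∀ {p n i} → 1 ≤ p → 2 ≤ n → 1 + (1 + 2 * p) ^ n ≢ 2 ^ i
1+[1+2p]^n≢2^i {suc p} {n} {i} (s≤s z≤n) 2≤n with even-or-odd n
... | zero , inj₁ refl = contradiction 2≤n λ ()
... | zero , inj₂ refl = contradiction 2≤n λ { (s≤s ()) }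
... | suc t , inj₁ refl = 1+[1+2p]^even≢2^i p t i
... | suc t , inj₂ refl = 1+[1+2p]^odd≢2^i p t i

[1+2p]^n≢1+2^i : ∀ {p n i} → 2 ≤ p → 2 ≤ n → (1 + 2 * p) ^ n ≢ 1 + 2 ^ i
[1+2p]^n≢1+2^i {suc (suc p)} {n} {i} (s≤s (s≤s z≤n)) 2≤n with even-or-odd n
... | zero , inj₁ refl = contradiction 2≤n λ ()
... | zero , inj₂ refl = contradiction 2≤n λ { (s≤s ()) }
... | suc t , inj₁ refl = [1+2p]^even≢1+2^i p t i
... | suc t , inj₂ refl = [1+2p]^odd≢1+2^i (suc p) t i

2+2p≡2^i⇒p≡3 : ∀ {p i} → Prime p → Prime (1 + 2 * p) → 2 + 2 * p ≡ 2 ^ i → p ≡ 3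
2+2p≡2^i⇒p≡3 {p} {suc j} pp pq eq with residue-mod-3 p
... | m , inj₁ refl with prime⇒irreducible pp (m∣m*n m)
...   | inj₁ ()
...   | inj₂ 3≡p = sym 3≡p
2+2p≡2^i⇒p≡3 {p} {suc j} pp pq eq | m , inj₂ (inj₁ p≡1+3m)
  with prime⇒irreducible pq (divides (1 + 2 * m) (trans (cong (λ x → 1 + 2 * x) p≡1+3m) (factor m)))
  where
  factor : ∀ m → 1 + 2 * (1 + 3 * m) ≡ (1 + 2 * m) * 3
  factor = solve-∀
... | inj₁ ()
... | inj₂ 3≡q =
  contradiction (subst Prime (sym (*-cancelˡ-≡ 1 p 2 (suc-injective 3≡q))) pp) ¬prime[1]
2+2p≡2^i⇒p≡3 {p} {suc j} pp pq eq | m , inj₂ (inj₂ p≡2+3m)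
  with 1+2b∣2^n⇒b≡0 {1} j
         (divides (1 + m) (trans (sym 1+p≡2^j) (trans (cong suc p≡2+3m) (factor m))))
  where
  factor : ∀ m → 1 + (2 + 3 * m) ≡ (1 + m) * 3
  factor = solve-∀
  1+p≡2^j : 1 + p ≡ 2 ^ j
  1+p≡2^j = *-cancelˡ-≡ (1 + p) (2 ^ j) 2 (trans (*-suc 2 p) eq)
... | ()

2p≡2^i⇒p≡2 : ∀ {p i} → Prime p → 2 * p ≡ 2 ^ i → p ≡ 2
2p≡2^i⇒p≡2 {p} {i} pp eq = prime∣q^n⇒≡q i pp prime[2] (subst (p ∣_) eq (n∣m*n 2))

1+[1+2p]^[1+n]≡2^i⇒n≡0∧p≡3 : ∀ {p} n i → Prime p → Prime (1 + 2 * p) →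
                              1 + (1 + 2 * p) ^ suc n ≡ 2 ^ i → n ≡ 0 × p ≡ 3 × i ≡ 3
1+[1+2p]^[1+n]≡2^i⇒n≡0∧p≡3 {p} zero i pp pq eq
  with 2+2p≡2^i⇒p≡3 {p} {i} pp pq (trans (cong (2 +_) (sym (*-identityʳ (2 * p)))) eq)
... | refl = refl , refl , ^-injectiveʳ 2 (s≤s (s≤s z≤n)) (sym eq)
1+[1+2p]^[1+n]≡2^i⇒n≡0∧p≡3 {p} (suc n) i pp pq eq =
  contradiction eq (1+[1+2p]^n≢2^i {p} {suc (suc n)} {i} (<⇒≤ (prime⇒2≤ pp)) (s≤s (s≤s z≤n)))

[1+2p]^[1+n]≡1+2^i⇒n≡0∧p≡2 : ∀ {p} n i → Prime p →
                              (1 + 2 * p) ^ suc n ≡ 1 + 2 ^ i → n ≡ 0 × p ≡ 2 × i ≡ 2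
[1+2p]^[1+n]≡1+2^i⇒n≡0∧p≡2 {p} zero i pp eq
  with 2p≡2^i⇒p≡2 {p} {i} pp (trans (sym (*-identityʳ (2 * p))) (suc-injective eq))
... | refl = refl , refl , ^-injectiveʳ 2 (s≤s (s≤s z≤n)) (sym (suc-injective eq))
[1+2p]^[1+n]≡1+2^i⇒n≡0∧p≡2 {p} (suc n) i pp eq =
  contradiction eq ([1+2p]^n≢1+2^i {p} {suc (suc n)} {i} (prime⇒2≤ pp) (s≤s (s≤s z≤n)))

1+2^[1+e]*x≡z^2⇒z≡1+2a : ∀ e x z → 1 + 2 ^ suc e * x ≡ z ^ 2 →
                         ∃[ a ] z ≡ 1 + 2 * a × a * (1 + a) * 4 ≡ 2 ^ suc e * x
1+2^[1+e]*x≡z^2⇒z≡1+2a e x z eq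
  with n^2-odd⇒n-odd {z} {2 ^ e * x} (trans (sym eq) (cong suc (*-assoc 2 (2 ^ e) x)))
... | a , refl = a , refl , suc-injective (trans (sym ([1+2a]^2≡1+a[1+a]*4 a)) (sym eq))

[m^k*x]^n≡m^[k*n]*x^n : ∀ m k x n → (m ^ k * x) ^ n ≡ m ^ (k * n) * x ^ n
[m^k*x]^n≡m^[k*n]*x^n m k x n = trans (^-distrib-* (m ^ k) x n) (cong (_* x ^ n) (^-*-assoc m k n))

1+[2^k*[1+2p]]^y≡z^2-solutions : ∀ {p} k y z → Prime p → Prime (1 + 2 * p) → 1 ≤ k →
    1 + (2 ^ k * (1 + 2 * p)) ^ y ≡ z ^ 2 →
    (p ≡ 2 × k ≡ 4 × y ≡ 1 × z ≡ 9) ⊎ (p ≡ 3 × k ≡ 5 × y ≡ 1 × z ≡ 15)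
1+[2^k*[1+2p]]^y≡z^2-solutions k zero z _ _ _ eq = contradiction eq (2≢n^2 z)
1+[2^k*[1+2p]]^y≡z^2-solutions {p} (suc k) (suc n) z pp pq _ eq
  with 1+2^[1+e]*x≡z^2⇒z≡1+2a (n + k * suc n) ((1 + 2 * p) ^ suc n) z
         (trans (cong suc (sym ([m^k*x]^n≡m^[k*n]*x^n 2 (suc k) (1 + 2 * p) (suc n)))) eq)
... | a , refl , 4a[1+a]≡2^E*Q
  with consecutive-product-split {p} pq n a (suc k * suc n) 4a[1+a]≡2^E*Q
...   | i , E≡i+2 , inj₁ (refl , 1+Q≡2^i)
  with 1+[1+2p]^[1+n]≡2^i⇒n≡0∧p≡3 n i pp pq 1+Q≡2^i
...     | refl , refl , refl = inj₂ (refl , trans (sym (*-identityʳ (suc k))) E≡i+2 , refl , refl)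
1+[2^k*[1+2p]]^y≡z^2-solutions (suc k) (suc n) z pp pq _ eq
  | a , refl , _ | i , E≡i+2 , inj₂ (1+a≡Q , refl)
  with [1+2p]^[1+n]≡1+2^i⇒n≡0∧p≡2 n i pp (sym 1+a≡Q)
...     | refl , refl , refl = inj₁ (refl , trans (sym (*-identityʳ (suc k))) E≡i+2 , refl , refl)

lemma2p5 : (p k y z : ℕ) → SophieGermainPrime p → 1 ≤ k →
    1 + (2 ^ k * (2 * p + 1)) ^ y ≡ z ^ 2 →
    (p ≡ 2 × k ≡ 4 × y ≡ 1 × z ≡ 9) ⊎ (p ≡ 3 × k ≡ 5 × y ≡ 1 × z ≡ 15)
lemma2p5 p k y z (pp , pq) 1≤k eq =
  1+[2^k*[1+2p]]^y≡z^2-solutions k y z pp (subst Prime 2p+1≡1+2p pq) 1≤k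
    (subst (λ q → 1 + (2 ^ k * q) ^ y ≡ z ^ 2) 2p+1≡1+2p eq)
  where
  2p+1≡1+2p : 2 * p + 1 ≡ 1 + 2 * p
  2p+1≡1+2p = +-comm (2 * p) 1
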